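{- Let $\mathcal C=(c_{ij})_{i,j\ge0}$ be an infinite tridiagonal matrix with indeterminate (generic) nonzero entries, and $\mathcal Z_k=(\mathcal C^k)_{0,0}$. For every partition $\lambda=(\lambda_1\ge\dots\ge\lambda_n\ge0)$, $$\mathcal K_\lambda=\det\big(\mathcal K_{(\lambda_i+j-i,0,\dots,0)}\big)_{i,j=1}^n,$$ where the sequence $(\lambda_i+j-i,0,\dots,0)$ in the $(i,j)$ entry has exactly $n-j$ zeros.
   Context: For an integer sequence $\mu=(\mu_1,\dots,\mu_p)$ with $\mu_i+p-i\ge0$ for all $i$, define $$\mathcal K_{\mu}=\frac{\det\big(\mathcal Z_{\mu_i+2p-i-j}\big)_{i,j=1}^p}{\det\big(\mathcal Z_{2p-i-j}\big)_{i,j=1}^p}.$$ (For the entries on the right-hand side, $p=n-j+1$ and the condition $\mu_1+p-1=\lambda_i+n-i\ge0$ holds.) Here $c_{ij}=0$ whenever $|i-j|>1$, and the entries are assumed generic so that all denominators are nonzero. -}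

module Defs where

open import Level using (Level; _⊔_) renaming (suc to lsuc)
open import Algebra.Bundles using (CommutativeRing)
open import Data.Nat as ℕ using (ℕ; zero; suc; _∸_)
open import Data.Fin as Fin using (Fin; zero; suc; toℕ; punchIn)
open import Data.Integer as ℤ using (ℤ; +_; -[1+_])
open import Data.Sum using (_⊎_)
open import Relation.Nullary using (¬_)

record Field (c ℓ : Level) : Set (lsuc (c ⊔ ℓ)) where
  field
    commutativeRing : CommutativeRing c ℓ
  open CommutativeRing commutativeRing public
  infix 8 _⁻¹
  field
    _⁻¹        : Carrier → Carrier
    ⁻¹-inverse : ∀ x → ¬ (x ≈ 0#) → x * (x ⁻¹) ≈ 1#
    0≉1        : ¬ (0# ≈ 1#)

module _ {c ℓ : Level} (F : Field c ℓ) where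
  open Field F using (Carrier; _≈_; _+_; _*_; -_; 0#; 1#; _⁻¹)

  ΣFin : (m : ℕ) → (Fin m → Carrier) → Carrier
  ΣFin zero    f = 0#
  ΣFin (suc m) f = f zero + ΣFin m (λ k → f (suc k))

  signed : ℕ → Carrier → Carrier
  signed zero          x = x
  signed (suc zero)    x = - x
  signed (suc (suc k)) x = signed k x

  det : (m : ℕ) → (Fin m → Fin m → Carrier) → Carrier
  det zero    M = 1#
  det (suc m) M =
    ΣFin (suc m) (λ j → signed (toℕ j) (M zero j * det m (λ r s → M (suc r) (punchIn j s))))

  IsTridiagonal : (ℕ → ℕ → Carrier) → Set ℓ
  IsTridiagonal C = ∀ i j → (suc (suc i) ℕ.≤ j ⊎ suc (suc j) ℕ.≤ i) → C i j ≈ 0#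

  BandNonzero : (ℕ → ℕ → Carrier) → Set ℓ
  BandNonzero C = ∀ i j → j ℕ.≤ suc i → i ℕ.≤ suc j → ¬ (C i j ≈ 0#)

  module Tri (C : ℕ → ℕ → Carrier) where
    -- entries of C^k. Row i of a tridiagonal C is supported on columns
    -- l ≤ i+1, so the (otherwise infinite) product sum runs over l < i+2.
    pow : ℕ → ℕ → ℕ → Carrier
    pow zero    i j with i ℕ.≟ j
    ... | Relation.Nullary.yes _ = 1#
    ... | Relation.Nullary.no  _ = 0#
    pow (suc k) i j = ΣFin (suc (suc i)) (λ l → C i (toℕ l) * pow k (toℕ l) j)

    𝒵 : ℕ → Carrier
    𝒵 k = pow k 0 0

    -- 𝒵 at an integer index (negative indices never occur under the
    -- standing condition μ_i + p - i ≥ 0; they are sent to 0)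
    𝒵ℤ : ℤ → Carrier
    𝒵ℤ (+ k)      = 𝒵 k
    𝒵ℤ -[1+ k ]   = 0#

    -- numerator matrix (𝒵_{μ_i + 2p - i - j})_{i,j=1}^p, written 0-based
    numMat : (p : ℕ) → (Fin p → ℤ) → Fin p → Fin p → Carrier
    numMat p μ i j =
      𝒵ℤ (μ i ℤ.+ (+ (2 ℕ.* p)) ℤ.- (+ (toℕ i ℕ.+ toℕ j ℕ.+ 2)))

    hankel : ℕ → Carrier
    hankel p = det p (λ i j → 𝒵 (2 ℕ.* p ∸ (toℕ i ℕ.+ toℕ j ℕ.+ 2)))

    𝒦 : (p : ℕ) → (Fin p → ℤ) → Carrier
    𝒦 p μ = det p (numMat p μ) * (hankel p ⁻¹)

headSeq : ℤ → (m : ℕ) → Fin m → ℤ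
headSeq a (suc m) zero    = a
headSeq a (suc m) (suc _) = + 0

IsPartition : {n : ℕ} → (Fin n → ℕ) → Set
IsPartition {n} λ′ = ∀ (i j : Fin n) → i Fin.≤ j → λ′ j ℕ.≤ λ′ i

-- Expanding the numerator of 𝒦_(a,0,…,0) of size p along its first row gives
-- 𝒦_(a,0,…,0) = Σ_t w^p_t 𝒵_(a+2p−t−2), where the weights w^p_t (signed cofactors of the
-- Hankel block, divided by the Hankel determinant H_p) do not depend on a.  Hence the
-- (i,j) entry of the right-hand matrix is Σ_t w^(n−j)_t 𝒵_(λ_i+2n−i−(j+t)−2), i.e. column j of it
-- is a combination of the columns j, j+1, … of the numerator matrix X of 𝒦_λ: it is X U
-- with U upper triangular.  By multilinearity and alternation in columns its determinant
-- is det X · Π_j U_jj, and the diagonal entries U_jj = H_(n−j−1)/H_(n−j) telescope to 1/H_n.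
module Submission where

open import Defs
open import Level using (Level)
open import Data.Nat as ℕ using (ℕ; zero; suc; _≤_; _<_; _<?_; _∸_; z≤n; s≤s)
import Data.Nat.Properties as ℕ
import Data.Nat.Tactic.RingSolver as ℕ-Solver
open import Data.Integer as ℤ using (ℤ; +_)
import Data.Integer.Properties as ℤ
import Data.Integer.Tactic.RingSolver as ℤ-Solver
open import Data.Fin using (Fin; zero; suc; toℕ; punchIn; punchOut; inject₁; fromℕ<) renaming (_≟_ to _≟ᶠ_)
import Data.Fin.Properties as Fin
open import Data.List using (_∷_; [])
open import Data.Product using (_×_; _,_)
open import Data.Sum using (_⊎_; inj₁; inj₂)
open import Data.Vec.Functional using (updateAt)
import Data.Vec.Functional.Properties as Vec
open import Function using (_∘_)
open import Relation.Binary.Definitions using (tri<; tri≈; tri>)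
open import Relation.Binary.PropositionalEquality as ≡ using (_≡_; _≢_)
open import Relation.Nullary using (¬_; yes; no; contradiction)

1+[n∸1+m]+m≡n : ∀ {m n} → m < n → suc ((n ∸ suc m) ℕ.+ m) ≡ n
1+[n∸1+m]+m≡n {m} m<n = ≡.trans (≡.sym (ℕ.+-suc _ m)) (ℕ.m∸n+n≡m m<n)

+m-+n≡+[m∸n] : ∀ {m n} → n ≤ m → + m ℤ.- + n ≡ + (m ∸ n)
+m-+n≡+[m∸n] {m} {n} n≤m = ≡.trans (ℤ.m-n≡m⊖n m n) (ℤ.⊖-≥ n≤m)

i+j+2≤l+2n : ∀ l {n i j} → i < n → j < n → i ℕ.+ j ℕ.+ 2 ≤ l ℕ.+ 2 ℕ.* n
i+j+2≤l+2n l {n} {i} {j} i<n j<n = begin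
  i ℕ.+ j ℕ.+ 2        ≡⟨ ℕ-Solver.solve (i ∷ j ∷ []) ⟩
  suc i ℕ.+ suc j      ≤⟨ ℕ.+-mono-≤ i<n j<n ⟩
  n ℕ.+ n              ≡⟨ ℕ-Solver.solve (n ∷ []) ⟩
  2 ℕ.* n              ≤⟨ ℕ.m≤n+m (2 ℕ.* n) l ⟩
  l ℕ.+ 2 ℕ.* n        ∎
  where open ℕ.≤-Reasoning

hankel-exponent : ∀ q r s → 2 ℕ.* suc q ∸ (suc r ℕ.+ suc s ℕ.+ 2) ≡ 2 ℕ.* q ∸ (r ℕ.+ s ℕ.+ 2)
hankel-exponent q r s = ≡.cong₂ _∸_ 2[1+q]≡2+2q 1+r+1+s+2≡2+[r+s+2]
  where
  2[1+q]≡2+2q : 2 ℕ.* suc q ≡ 2 ℕ.+ 2 ℕ.* q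
  2[1+q]≡2+2q = ℕ-Solver.solve (q ∷ [])
  1+r+1+s+2≡2+[r+s+2] : suc r ℕ.+ suc s ℕ.+ 2 ≡ 2 ℕ.+ (r ℕ.+ s ℕ.+ 2)
  1+r+1+s+2≡2+[r+s+2] = ℕ-Solver.solve (r ∷ s ∷ [])

headSeq-exponent : ∀ l {n i j t} → i < n → j ℕ.+ t < n →
  ((+ l ℤ.+ + j) ℤ.- + i) ℤ.+ + (2 ℕ.* (n ∸ j)) ℤ.- + (t ℕ.+ 2) ≡ + ((l ℕ.+ 2 ℕ.* n) ∸ (i ℕ.+ (j ℕ.+ t) ℕ.+ 2))
headSeq-exponent l {n} {i} {j} {t} i<n j+t<n = begin
  ((+ l ℤ.+ + j) ℤ.- + i) ℤ.+ + (2 ℕ.* D) ℤ.- + (t ℕ.+ 2)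
    ≡⟨ ≡.cong (λ x → ((+ l ℤ.+ + j) ℤ.- + i) ℤ.+ x ℤ.- + (t ℕ.+ 2)) (ℤ.pos-* 2 D) ⟩
  ((+ l ℤ.+ + j) ℤ.- + i) ℤ.+ + 2 ℤ.* + D ℤ.- (+ t ℤ.+ + 2)
    ≡⟨ identity (+ l) (+ i) (+ j) (+ t) (+ D) ⟩
  + l ℤ.+ + 2 ℤ.* (+ D ℤ.+ + j) ℤ.- + B
    ≡⟨ ≡.cong (λ m → + l ℤ.+ m ℤ.- + B) (ℤ.pos-* 2 (D ℕ.+ j)) ⟨
  + (l ℕ.+ 2 ℕ.* (D ℕ.+ j)) ℤ.- + B
    ≡⟨ ≡.cong (λ m → + (l ℕ.+ 2 ℕ.* m) ℤ.- + B) (ℕ.m∸n+n≡m j≤n) ⟩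
  + (l ℕ.+ 2 ℕ.* n) ℤ.- + B
    ≡⟨ +m-+n≡+[m∸n] (i+j+2≤l+2n l i<n j+t<n) ⟩
  + ((l ℕ.+ 2 ℕ.* n) ∸ B) ∎
  where
  open ≡.≡-Reasoning
  D = n ∸ j
  B = i ℕ.+ (j ℕ.+ t) ℕ.+ 2
  j≤n : j ≤ n
  j≤n = ℕ.≤-trans (ℕ.m≤m+n j t) (ℕ.<⇒≤ j+t<n)
  identity : ∀ l i j t D → ((l ℤ.+ j) ℤ.- i) ℤ.+ + 2 ℤ.* D ℤ.- (t ℤ.+ + 2)
                           ≡ l ℤ.+ + 2 ℤ.* (D ℤ.+ j) ℤ.- (i ℤ.+ (j ℤ.+ t) ℤ.+ + 2)
  identity = ℤ-Solver.solve-∀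

punchIn-adjacent : ∀ {m} {a b : Fin (suc m)} → toℕ b ≡ suc (toℕ a) → ∀ s →
                   punchIn a s ≡ punchIn b s ⊎ (punchIn a s ≡ b × punchIn b s ≡ a)
punchIn-adjacent {a = zero}  {suc zero}     e zero    = inj₂ (≡.refl , ≡.refl)
punchIn-adjacent {a = zero}  {suc zero}     e (suc s) = inj₁ ≡.refl
punchIn-adjacent {a = suc a} {suc b}        e zero    = inj₁ ≡.refl
punchIn-adjacent {a = suc a} {suc b}        e (suc s) with punchIn-adjacent (ℕ.suc-injective e) s
... | inj₁ eq         = inj₁ (≡.cong suc eq)
... | inj₂ (ea , eb)  = inj₂ (≡.cong suc ea , ≡.cong suc eb)

punchOut-adjacent : ∀ {m} {a b j : Fin (suc m)} (j≢a : j ≢ a) (j≢b : j ≢ b) →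
                    toℕ b ≡ suc (toℕ a) → toℕ (punchOut j≢b) ≡ suc (toℕ (punchOut j≢a))
punchOut-adjacent {a = zero}  {j = zero}           j≢a j≢b e = contradiction ≡.refl j≢a
punchOut-adjacent {a = suc a} {suc b} {zero}       j≢a j≢b e = ℕ.suc-injective e
punchOut-adjacent {a = zero}  {suc zero} {suc zero} j≢a j≢b e = contradiction ≡.refl j≢b
punchOut-adjacent {m = suc (suc m)} {zero} {suc zero} {suc (suc j)} j≢a j≢b e = ≡.refl
punchOut-adjacent {m = suc m} {suc a} {suc b} {suc j} j≢a j≢b e =
  ≡.cong suc (punchOut-adjacent (j≢a ∘ ≡.cong suc) (j≢b ∘ ≡.cong suc) (ℕ.suc-injective e))

module Product {ℓ₁ ℓ₂ : Level} (F : Field ℓ₁ ℓ₂) where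
  open Field F hiding (zero)
  open import Relation.Binary.Reasoning.Setoid setoid
  open import Algebra.Properties.CommutativeSemigroup *-commutativeSemigroup using (interchange)

  ∏ : ℕ → (ℕ → Carrier) → Carrier
  ∏ zero    f = 1#
  ∏ (suc k) f = ∏ k f * f k

  ∏-cong : ∀ k {f g : ℕ → Carrier} → (∀ j → j < k → f j ≈ g j) → ∏ k f ≈ ∏ k g
  ∏-cong zero    f≈g = refl
  ∏-cong (suc k) f≈g = *-cong (∏-cong k (λ j j<k → f≈g j (ℕ.m<n⇒m<1+n j<k))) (f≈g k (ℕ.n<1+n k))

  ∏-telescope : ∀ (g : ℕ → Carrier) k → (∀ j → j ≤ k → g j * g j ⁻¹ ≈ 1#) →
                ∏ k (λ j → g (suc j) * g j ⁻¹) ≈ g k * g 0 ⁻¹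
  ∏-telescope g zero    g-invertible = sym (g-invertible 0 z≤n)
  ∏-telescope g (suc k) g-invertible = begin
    ∏ k (λ j → g (suc j) * g j ⁻¹) * (g (suc k) * g k ⁻¹)
      ≈⟨ *-congʳ (∏-telescope g k (λ j j≤k → g-invertible j (ℕ.m≤n⇒m≤1+n j≤k))) ⟩
    (g k * g 0 ⁻¹) * (g (suc k) * g k ⁻¹)   ≈⟨ *-congʳ (*-comm (g k) (g 0 ⁻¹)) ⟩
    (g 0 ⁻¹ * g k) * (g (suc k) * g k ⁻¹)   ≈⟨ interchange (g 0 ⁻¹) (g k) (g (suc k)) (g k ⁻¹) ⟩
    (g 0 ⁻¹ * g (suc k)) * (g k * g k ⁻¹)   ≈⟨ *-cong (*-comm (g 0 ⁻¹) (g (suc k))) (g-invertible k (ℕ.n≤1+n k)) ⟩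
    (g (suc k) * g 0 ⁻¹) * 1#               ≈⟨ *-identityʳ _ ⟩
    g (suc k) * g 0 ⁻¹                      ∎

module Determinant {ℓ₁ ℓ₂ : Level} (F : Field ℓ₁ ℓ₂) where
  open Field F hiding (zero)
  open Product F using (∏)
  open import Relation.Binary.Reasoning.Setoid setoid
  open import Algebra.Properties.Group +-group using (ε⁻¹≈ε; ⁻¹-involutive)
  open import Algebra.Properties.AbelianGroup +-abelianGroup using (⁻¹-∙-comm)
  open import Algebra.Properties.Ring ring using (-‿distribʳ-*)
  open import Algebra.Properties.CommutativeSemigroup +-commutativeSemigroup
    using () renaming (interchange to +-interchange)
  open import Algebra.Properties.CommutativeSemigroup *-commutativeSemigroup using (x∙yz≈y∙xz; x∙yz≈yx∙z)

  ∑ : (m : ℕ) → (Fin m → Carrier) → Carrier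
  ∑ = ΣFin F

  ∑-cong : ∀ {m} {f g : Fin m → Carrier} → (∀ k → f k ≈ g k) → ∑ m f ≈ ∑ m g
  ∑-cong {zero}  f≈g = refl
  ∑-cong {suc m} f≈g = +-cong (f≈g zero) (∑-cong (f≈g ∘ suc))

  ∑-zero : ∀ {m} (f : Fin m → Carrier) → (∀ k → f k ≈ 0#) → ∑ m f ≈ 0#
  ∑-zero {zero}  f f≈0 = refl
  ∑-zero {suc m} f f≈0 = trans (+-cong (f≈0 zero) (∑-zero (f ∘ suc) (f≈0 ∘ suc))) (+-identityˡ 0#)

  ∑-distrib-+ : ∀ {m} (f g : Fin m → Carrier) → ∑ m (λ k → f k + g k) ≈ ∑ m f + ∑ m g
  ∑-distrib-+ {zero}  f g = sym (+-identityˡ 0#)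
  ∑-distrib-+ {suc m} f g = begin
    (f zero + g zero) + ∑ m (λ k → f (suc k) + g (suc k))   ≈⟨ +-congˡ (∑-distrib-+ (f ∘ suc) (g ∘ suc)) ⟩
    (f zero + g zero) + (∑ m (f ∘ suc) + ∑ m (g ∘ suc))     ≈⟨ +-interchange _ _ _ _ ⟩
    (f zero + ∑ m (f ∘ suc)) + (g zero + ∑ m (g ∘ suc))     ∎

  ∑-distribˡ-* : ∀ {m} x (f : Fin m → Carrier) → ∑ m (λ k → x * f k) ≈ x * ∑ m f
  ∑-distribˡ-* {zero}  x f = sym (zeroʳ x)
  ∑-distribˡ-* {suc m} x f = trans (+-congˡ (∑-distribˡ-* x (f ∘ suc))) (sym (distribˡ x _ _))

  ∑-single : ∀ {m} (f : Fin m → Carrier) a → (∀ k → k ≢ a → f k ≈ 0#) → ∑ m f ≈ f a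
  ∑-single f zero    f≈0 = trans (+-congˡ (∑-zero (f ∘ suc) (λ k → f≈0 (suc k) λ ()))) (+-identityʳ _)
  ∑-single f (suc a) f≈0 =
    trans (+-cong (f≈0 zero λ ()) (∑-single (f ∘ suc) a (λ k k≢a → f≈0 (suc k) (k≢a ∘ Fin.suc-injective))))
          (+-identityˡ _)

  ∑-pair : ∀ {m} (f : Fin m → Carrier) {a b} → a ≢ b →
           (∀ k → k ≢ a → k ≢ b → f k ≈ 0#) → ∑ m f ≈ f a + f b
  ∑-pair f {zero}  {zero}  a≢b f≈0 = contradiction ≡.refl a≢b
  ∑-pair f {zero}  {suc b} a≢b f≈0 =
    +-congˡ (∑-single (f ∘ suc) b (λ k k≢b → f≈0 (suc k) (λ ()) (k≢b ∘ Fin.suc-injective)))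
  ∑-pair f {suc a} {zero}  a≢b f≈0 =
    trans (+-congˡ (∑-single (f ∘ suc) a (λ k k≢a → f≈0 (suc k) (k≢a ∘ Fin.suc-injective) (λ ()))))
          (+-comm _ _)
  ∑-pair f {suc a} {suc b} a≢b f≈0 =
    trans (+-cong (f≈0 zero (λ ()) (λ ()))
                  (∑-pair (f ∘ suc) (a≢b ∘ ≡.cong suc)
                          (λ k k≢a k≢b → f≈0 (suc k) (k≢a ∘ Fin.suc-injective) (k≢b ∘ Fin.suc-injective))))
          (+-identityˡ _)

  ∑-single-zero : ∀ {m} (g : ℕ → Carrier) → 0 < m → (∀ t → 0 < t → t < m → g t ≈ 0#) →
           ∑ m (λ t → g (toℕ t)) ≈ g 0
  ∑-single-zero {suc m} g _ g≈0 =
    trans (+-congˡ (∑-zero _ (λ t → g≈0 (suc (toℕ t)) (s≤s z≤n) (s≤s (Fin.toℕ<n t))))) (+-identityʳ _)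

  signed-cong : ∀ k {x y} → x ≈ y → signed F k x ≈ signed F k y
  signed-cong zero          x≈y = x≈y
  signed-cong (suc zero)    x≈y = -‿cong x≈y
  signed-cong (suc (suc k)) x≈y = signed-cong k x≈y

  signed-zero : ∀ k → signed F k 0# ≈ 0#
  signed-zero zero          = refl
  signed-zero (suc zero)    = ε⁻¹≈ε
  signed-zero (suc (suc k)) = signed-zero k

  signed-+ : ∀ k x y → signed F k (x + y) ≈ signed F k x + signed F k y
  signed-+ zero          x y = refl
  signed-+ (suc zero)    x y = sym (⁻¹-∙-comm x y)
  signed-+ (suc (suc k)) x y = signed-+ k x y

  signed-* : ∀ k x y → signed F k (x * y) ≈ x * signed F k y
  signed-* zero          x y = refl
  signed-* (suc zero)    x y = -‿distribʳ-* x y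
  signed-* (suc (suc k)) x y = signed-* k x y

  signed-suc : ∀ k x → signed F (suc k) x ≈ - signed F k x
  signed-suc zero          x = refl
  signed-suc (suc zero)    x = sym (⁻¹-involutive x)
  signed-suc (suc (suc k)) x = signed-suc k x

  Matrix : ℕ → Set ℓ₁
  Matrix n = Fin n → Fin n → Carrier

  infix 4 _≋_
  _≋_ : ∀ {n} → Matrix n → Matrix n → Set ℓ₂
  M ≋ N = ∀ r s → M r s ≈ N r s

  minor : ∀ {m} → Matrix (suc m) → Fin (suc m) → Matrix m
  minor M j r s = M (suc r) (punchIn j s)

  laplaceTerm : ∀ {m} → Matrix (suc m) → Fin (suc m) → Carrier
  laplaceTerm {m} M j = signed F (toℕ j) (M zero j * det F m (minor M j))

  det-cong : ∀ {n} {M N : Matrix n} → M ≋ N → det F n M ≈ det F n N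
  det-cong {zero}  M≋N = refl
  det-cong {suc m} M≋N = ∑-cong λ j → signed-cong (toℕ j)
    (*-cong (M≋N zero j) (det-cong λ r s → M≋N (suc r) (punchIn j s)))

  replaceCol : ∀ {n} → Matrix n → Fin n → (Fin n → Carrier) → Matrix n
  replaceCol M c y r = updateAt (M r) c (λ _ → y r)

  replaceCol-at : ∀ {n} (M : Matrix n) c y r → replaceCol M c y r c ≡ y r
  replaceCol-at M c y r = Vec.updateAt-updates c (M r)

  replaceCol-off : ∀ {n} (M : Matrix n) {c s} y r → s ≢ c → replaceCol M c y r s ≡ M r s
  replaceCol-off M {c} {s} y r = Vec.updateAt-minimal s c (M r)

  replaceCol-cong : ∀ {n} (M : Matrix n) c {y z} → (∀ r → y r ≈ z r) → replaceCol M c y ≋ replaceCol M c z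
  replaceCol-cong M c {y} {z} y≈z r s with s ≟ᶠ c
  ... | yes ≡.refl = trans (reflexive (replaceCol-at M s y r)) (trans (y≈z r) (reflexive (≡.sym (replaceCol-at M s z r))))
  ... | no s≢c     = reflexive (≡.trans (replaceCol-off M y r s≢c) (≡.sym (replaceCol-off M z r s≢c)))

  replaceCol-own : ∀ {n} (M : Matrix n) c {y} → (∀ r → y r ≈ M r c) → replaceCol M c y ≋ M
  replaceCol-own M c {y} y≈Mc r s with s ≟ᶠ c
  ... | yes ≡.refl = trans (reflexive (replaceCol-at M s y r)) (y≈Mc r)
  ... | no s≢c     = reflexive (replaceCol-off M y r s≢c)

  replaceCol-comm : ∀ {n} (M : Matrix n) {a b} x y → a ≢ b →
                    replaceCol (replaceCol M a x) b y ≋ replaceCol (replaceCol M b y) a x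
  replaceCol-comm M {a} {b} x y a≢b r = reflexive ∘ Vec.updateAt-commutes b a (a≢b ∘ ≡.sym) (M r)

  minor-replaceCol-self : ∀ {m} (M : Matrix (suc m)) c y → minor (replaceCol M c y) c ≋ minor M c
  minor-replaceCol-self M c y r s = reflexive (replaceCol-off M y (suc r) (Fin.punchInᵢ≢i c s))

  minor-replaceCol : ∀ {m} (M : Matrix (suc m)) {c j} y (j≢c : j ≢ c) →
                     minor (replaceCol M c y) j ≋ replaceCol (minor M j) (punchOut j≢c) (y ∘ suc)
  minor-replaceCol M {c} {j} y j≢c r s with s ≟ᶠ punchOut j≢c
  ... | yes ≡.refl = reflexive (≡.trans (≡.cong (replaceCol M c y (suc r)) (Fin.punchIn-punchOut j≢c))
                       (≡.trans (replaceCol-at M c y (suc r)) (≡.sym (replaceCol-at (minor M j) s (y ∘ suc) r))))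
  ... | no s≢p     = reflexive (≡.trans (replaceCol-off M y (suc r) punchIn≢c)
                                        (≡.sym (replaceCol-off (minor M j) (y ∘ suc) r s≢p)))
    where
    punchIn≢c : punchIn j s ≢ c
    punchIn≢c e = s≢p (Fin.punchIn-injective j s _ (≡.trans e (≡.sym (Fin.punchIn-punchOut j≢c))))

  laplaceTerm-replaceCol-at : ∀ {m} (M : Matrix (suc m)) c y →
    laplaceTerm (replaceCol M c y) c ≈ signed F (toℕ c) (y zero * det F m (minor M c))
  laplaceTerm-replaceCol-at M c y = signed-cong (toℕ c)
    (*-cong (reflexive (replaceCol-at M c y zero)) (det-cong (minor-replaceCol-self M c y)))

  laplaceTerm-replaceCol-off : ∀ {m} (M : Matrix (suc m)) {c j} y (j≢c : j ≢ c) →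
    laplaceTerm (replaceCol M c y) j ≈
    signed F (toℕ j) (M zero j * det F m (replaceCol (minor M j) (punchOut j≢c) (y ∘ suc)))
  laplaceTerm-replaceCol-off M {j = j} y j≢c = signed-cong (toℕ j)
    (*-cong (reflexive (replaceCol-off M y zero j≢c)) (det-cong (minor-replaceCol M y j≢c)))

  det-replaceCol-+ : ∀ {n} (M : Matrix n) c y z →
    det F n (replaceCol M c (λ r → y r + z r)) ≈ det F n (replaceCol M c y) + det F n (replaceCol M c z)
  det-replaceCol-+ {suc m} M c y z =
    trans (∑-cong term) (∑-distrib-+ (laplaceTerm (replaceCol M c y)) (laplaceTerm (replaceCol M c z)))
    where
    y+z : Fin (suc m) → Carrier
    y+z r = y r + z r
    term : ∀ j → laplaceTerm (replaceCol M c y+z) j ≈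
                 laplaceTerm (replaceCol M c y) j + laplaceTerm (replaceCol M c z) j
    term j with j ≟ᶠ c
    ... | yes ≡.refl = begin
      laplaceTerm (replaceCol M j y+z) j                  ≈⟨ laplaceTerm-replaceCol-at M j y+z ⟩
      signed F (toℕ j) ((y zero + z zero) * D)            ≈⟨ signed-cong (toℕ j) (distribʳ D (y zero) (z zero)) ⟩
      signed F (toℕ j) (y zero * D + z zero * D)          ≈⟨ signed-+ (toℕ j) (y zero * D) (z zero * D) ⟩
      signed F (toℕ j) (y zero * D) + signed F (toℕ j) (z zero * D)
        ≈⟨ +-cong (laplaceTerm-replaceCol-at M j y) (laplaceTerm-replaceCol-at M j z) ⟨
      laplaceTerm (replaceCol M j y) j + laplaceTerm (replaceCol M j z) j ∎
      where D = det F m (minor M j)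
    ... | no j≢c = begin
      laplaceTerm (replaceCol M c y+z) j                                ≈⟨ laplaceTerm-replaceCol-off M y+z j≢c ⟩
      signed F (toℕ j) (M zero j * det F m (replaceCol N p (y+z ∘ suc)))
        ≈⟨ signed-cong (toℕ j) (*-congˡ (det-replaceCol-+ N p (y ∘ suc) (z ∘ suc))) ⟩
      signed F (toℕ j) (M zero j * (A + B))                             ≈⟨ signed-cong (toℕ j) (distribˡ _ A B) ⟩
      signed F (toℕ j) (M zero j * A + M zero j * B)                    ≈⟨ signed-+ (toℕ j) _ _ ⟩
      signed F (toℕ j) (M zero j * A) + signed F (toℕ j) (M zero j * B)
        ≈⟨ +-cong (laplaceTerm-replaceCol-off M y j≢c) (laplaceTerm-replaceCol-off M z j≢c) ⟨
      laplaceTerm (replaceCol M c y) j + laplaceTerm (replaceCol M c z) j ∎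
      where
      N = minor M j
      p = punchOut j≢c
      A = det F m (replaceCol N p (y ∘ suc))
      B = det F m (replaceCol N p (z ∘ suc))

  det-replaceCol-* : ∀ {n} (M : Matrix n) c a y →
    det F n (replaceCol M c (λ r → a * y r)) ≈ a * det F n (replaceCol M c y)
  det-replaceCol-* {suc m} M c a y = trans (∑-cong term) (∑-distribˡ-* a (laplaceTerm (replaceCol M c y)))
    where
    ay : Fin (suc m) → Carrier
    ay r = a * y r
    term : ∀ j → laplaceTerm (replaceCol M c ay) j ≈ a * laplaceTerm (replaceCol M c y) j
    term j with j ≟ᶠ c
    ... | yes ≡.refl = begin
      laplaceTerm (replaceCol M j ay) j           ≈⟨ laplaceTerm-replaceCol-at M j ay ⟩
      signed F (toℕ j) ((a * y zero) * D)         ≈⟨ signed-cong (toℕ j) (*-assoc a (y zero) D) ⟩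
      signed F (toℕ j) (a * (y zero * D))         ≈⟨ signed-* (toℕ j) a (y zero * D) ⟩
      a * signed F (toℕ j) (y zero * D)           ≈⟨ *-congˡ (laplaceTerm-replaceCol-at M j y) ⟨
      a * laplaceTerm (replaceCol M j y) j        ∎
      where D = det F m (minor M j)
    ... | no j≢c = begin
      laplaceTerm (replaceCol M c ay) j                                ≈⟨ laplaceTerm-replaceCol-off M ay j≢c ⟩
      signed F (toℕ j) (M zero j * det F m (replaceCol N p (ay ∘ suc)))
        ≈⟨ signed-cong (toℕ j) (*-congˡ (det-replaceCol-* N p a (y ∘ suc))) ⟩
      signed F (toℕ j) (M zero j * (a * A))       ≈⟨ signed-cong (toℕ j) (x∙yz≈y∙xz (M zero j) a A) ⟩
      signed F (toℕ j) (a * (M zero j * A))       ≈⟨ signed-* (toℕ j) a (M zero j * A) ⟩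
      a * signed F (toℕ j) (M zero j * A)         ≈⟨ *-congˡ (laplaceTerm-replaceCol-off M y j≢c) ⟨
      a * laplaceTerm (replaceCol M c y) j        ∎
      where
      N = minor M j
      p = punchOut j≢c
      A = det F m (replaceCol N p (y ∘ suc))

  det-replaceCol-∑ : ∀ {n} (M : Matrix n) c {q} (w : Fin q → Carrier) (Y : Fin q → Fin n → Carrier) →
    det F n (replaceCol M c (λ r → ∑ q (λ t → w t * Y t r))) ≈ ∑ q (λ t → w t * det F n (replaceCol M c (Y t)))
  det-replaceCol-∑ {n} M c {zero} w Y = begin
    det F n (replaceCol M c (λ _ → 0#))       ≈⟨ det-cong (replaceCol-cong M c (λ _ → sym (zeroˡ 0#))) ⟩
    det F n (replaceCol M c (λ _ → 0# * 0#))  ≈⟨ det-replaceCol-* M c 0# (λ _ → 0#) ⟩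
    0# * det F n (replaceCol M c (λ _ → 0#))  ≈⟨ zeroˡ _ ⟩
    0#                                        ∎
  det-replaceCol-∑ {n} M c {suc q} w Y = begin
    det F n (replaceCol M c (λ r → w zero * Y zero r + rest r))
      ≈⟨ det-replaceCol-+ M c (λ r → w zero * Y zero r) rest ⟩
    det F n (replaceCol M c (λ r → w zero * Y zero r)) + det F n (replaceCol M c rest)
      ≈⟨ +-cong (det-replaceCol-* M c (w zero) (Y zero)) (det-replaceCol-∑ M c (w ∘ suc) (Y ∘ suc)) ⟩
    w zero * det F n (replaceCol M c (Y zero)) + ∑ q (λ t → w (suc t) * det F n (replaceCol M c (Y (suc t)))) ∎
    where
    rest : Fin n → Carrier
    rest r = ∑ q (λ t → w (suc t) * Y (suc t) r)

  -- Only the Laplace terms at a and b survive; their minors agree and their signs differ.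
  det-adjacentEqualColumns : ∀ {n} (M : Matrix n) {a b} → toℕ b ≡ suc (toℕ a) →
                             (∀ r → M r a ≈ M r b) → det F n M ≈ 0#
  det-adjacentEqualColumns {suc m} M {a} {b} b≡1+a Ma≈Mb = trans (∑-pair (laplaceTerm M) a≢b vanish) cancel
    where
    a≢b : a ≢ b
    a≢b a≡b = ℕ.<⇒≢ (ℕ.n<1+n (toℕ a)) (≡.trans (≡.cong toℕ a≡b) b≡1+a)

    vanish : ∀ j → j ≢ a → j ≢ b → laplaceTerm M j ≈ 0#
    vanish j j≢a j≢b = trans (signed-cong (toℕ j) (trans (*-congˡ minor≈0) (zeroʳ _))) (signed-zero (toℕ j))
      where
      column : ∀ {k} (j≢k : j ≢ k) r → minor M j r (punchOut j≢k) ≡ M (suc r) k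
      column j≢k r = ≡.cong (M (suc r)) (Fin.punchIn-punchOut j≢k)
      minor≈0 : det F m (minor M j) ≈ 0#
      minor≈0 = det-adjacentEqualColumns (minor M j) (punchOut-adjacent j≢a j≢b b≡1+a) λ r →
        trans (reflexive (column j≢a r)) (trans (Ma≈Mb (suc r)) (reflexive (≡.sym (column j≢b r))))

    minor-b≋minor-a : minor M b ≋ minor M a
    minor-b≋minor-a r s with punchIn-adjacent b≡1+a s
    ... | inj₁ eq         = reflexive (≡.cong (M (suc r)) (≡.sym eq))
    ... | inj₂ (ea , eb)  = trans (reflexive (≡.cong (M (suc r)) eb))
                              (trans (Ma≈Mb (suc r)) (reflexive (≡.cong (M (suc r)) (≡.sym ea))))

    cancel : laplaceTerm M a + laplaceTerm M b ≈ 0#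
    cancel = begin
      laplaceTerm M a + laplaceTerm M b
        ≡⟨ ≡.cong (λ k → laplaceTerm M a + signed F k (M zero b * det F m (minor M b))) b≡1+a ⟩
      laplaceTerm M a + signed F (suc (toℕ a)) (M zero b * det F m (minor M b))
        ≈⟨ +-congˡ (signed-suc (toℕ a) _) ⟩
      laplaceTerm M a + - signed F (toℕ a) (M zero b * det F m (minor M b))
        ≈⟨ +-congˡ (-‿cong (signed-cong (toℕ a) (*-cong (sym (Ma≈Mb zero)) (det-cong minor-b≋minor-a)))) ⟩
      laplaceTerm M a + - laplaceTerm M a
        ≈⟨ -‿inverseʳ _ ⟩
      0# ∎

  swapCols : ∀ {n} → Matrix n → Fin n → Fin n → Matrix n
  swapCols M a b = replaceCol (replaceCol M b (λ r → M r a)) a (λ r → M r b)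

  -- Expand the vanishing determinant whose columns a and b both equal column a + column b.
  det-swapCols : ∀ {n} (M : Matrix n) {a b} → a ≢ b →
                 (∀ N → (∀ r → N r a ≈ N r b) → det F n N ≈ 0#) →
                 det F n M + det F n (swapCols M a b) ≈ 0#
  det-swapCols {n} M {a} {b} a≢b alternating = begin
    det F n M + det F n (swapCols M a b)        ≈⟨ +-cong (det-cong M≋Quv) (det-cong swap≋Qvu) ⟩
    det F n (Q u v) + det F n (Q v u)           ≈⟨ +-cong (+-identityˡ _) (+-identityʳ _) ⟨
    (0# + det F n (Q u v)) + (det F n (Q v u) + 0#)
      ≈⟨ +-cong (+-congʳ (equal Q (Q-a u u) (Q-b u u))) (+-congˡ (equal Q (Q-a v v) (Q-b v v))) ⟨
    (det F n (Q u u) + det F n (Q u v)) + (det F n (Q v u) + det F n (Q v v))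
      ≈⟨ +-cong (det-replaceCol-+ (replaceCol M a u) b u v) (det-replaceCol-+ (replaceCol M a v) b u v) ⟨
    det F n (Q u w) + det F n (Q v w)           ≈⟨ +-cong (det-cong (replaceCol-comm M u w a≢b))
                                                          (det-cong (replaceCol-comm M v w a≢b)) ⟩
    det F n (R u w) + det F n (R v w)           ≈⟨ det-replaceCol-+ (replaceCol M b w) a u v ⟨
    det F n (R w w)                             ≈⟨ equal R (R-a w w) (R-b w w) ⟩
    0#                                          ∎
    where
    u v w : Fin n → Carrier
    u r = M r a
    v r = M r b
    w r = u r + v r
    Q R : (Fin n → Carrier) → (Fin n → Carrier) → Matrix n
    Q x y = replaceCol (replaceCol M a x) b y
    R x y = replaceCol (replaceCol M b y) a x
    Q-a : ∀ x y r → Q x y r a ≡ x r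
    Q-a x y r = ≡.trans (replaceCol-off (replaceCol M a x) y r a≢b) (replaceCol-at M a x r)
    Q-b : ∀ x y r → Q x y r b ≡ y r
    Q-b x y r = replaceCol-at (replaceCol M a x) b y r
    R-a : ∀ x y r → R x y r a ≡ x r
    R-a x y r = replaceCol-at (replaceCol M b y) a x r
    R-b : ∀ x y r → R x y r b ≡ y r
    R-b x y r = ≡.trans (replaceCol-off (replaceCol M b y) x r (a≢b ∘ ≡.sym)) (replaceCol-at M b y r)
    equal : ∀ (S : (Fin n → Carrier) → (Fin n → Carrier) → Matrix n) {x} →
            (∀ r → S x x r a ≡ x r) → (∀ r → S x x r b ≡ x r) → det F n (S x x) ≈ 0#
    equal S Sa Sb = alternating (S _ _) (λ r → reflexive (≡.trans (Sa r) (≡.sym (Sb r))))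
    swap≋Qvu : swapCols M a b ≋ Q v u
    swap≋Qvu r s = sym (replaceCol-comm M v u a≢b r s)
    M≋Quv : M ≋ Q u v
    M≋Quv r s = sym (trans (replaceCol-own (replaceCol M a u) b v≈col-b r s) (replaceCol-own M a (λ _ → refl) r s))
      where
      v≈col-b : ∀ r → v r ≈ replaceCol M a u r b
      v≈col-b r = reflexive (≡.sym (replaceCol-off M u r (a≢b ∘ ≡.sym)))

  -- Swapping b with its left neighbour b′ brings the repeated column one step closer to a.
  det-equalColumns-apart : ∀ d {n} (M : Matrix n) {a b} → toℕ b ≡ suc (d ℕ.+ toℕ a) →
                           (∀ r → M r a ≈ M r b) → det F n M ≈ 0#
  det-equalColumns-apart zero    M b≡1+a Ma≈Mb = det-adjacentEqualColumns M b≡1+a Ma≈Mb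
  det-equalColumns-apart (suc d) {n} M {a} {suc b} b≡2+d+a Ma≈Mb = begin
    det F n M                                      ≈⟨ +-identityʳ _ ⟨
    det F n M + 0#                                 ≈⟨ +-congˡ swapped≈0 ⟨
    det F n M + det F n (swapCols M b′ (suc b))    ≈⟨ det-swapCols M b′≢b (λ N → det-adjacentEqualColumns N b≡1+b′) ⟩
    0#                                             ∎
    where
    b′ = inject₁ b
    b≡1+b′ : toℕ (suc b) ≡ suc (toℕ b′)
    b≡1+b′ = ≡.cong suc (≡.sym (Fin.toℕ-inject₁ b))
    b′≡1+d+a : toℕ b′ ≡ suc (d ℕ.+ toℕ a)
    b′≡1+d+a = ≡.trans (Fin.toℕ-inject₁ b) (ℕ.suc-injective b≡2+d+a)
    b′≢b : b′ ≢ suc b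
    b′≢b e = ℕ.<⇒≢ (ℕ.n<1+n (toℕ b′)) (≡.trans (≡.cong toℕ e) b≡1+b′)
    a<b′ : toℕ a < toℕ b′
    a<b′ = ≡.subst (toℕ a <_) (≡.sym b′≡1+d+a) (s≤s (ℕ.m≤n+m (toℕ a) d))
    a≢b′ : a ≢ b′
    a≢b′ e = ℕ.<⇒≢ a<b′ (≡.cong toℕ e)
    a≢b : a ≢ suc b
    a≢b e = ℕ.<⇒≢ (ℕ.<-trans a<b′ (ℕ.≤-reflexive (≡.sym b≡1+b′))) (≡.cong toℕ e)
    swapped≈0 : det F n (swapCols M b′ (suc b)) ≈ 0#
    swapped≈0 = det-equalColumns-apart d (swapCols M b′ (suc b)) b′≡1+d+a λ r → begin
      swapCols M b′ (suc b) r a   ≡⟨ replaceCol-off N Mb r a≢b′ ⟩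
      N r a                       ≡⟨ replaceCol-off M Mb′ r a≢b ⟩
      M r a                       ≈⟨ Ma≈Mb r ⟩
      M r (suc b)                 ≡⟨ replaceCol-at N b′ Mb r ⟨
      swapCols M b′ (suc b) r b′  ∎
      where
      Mb Mb′ : Fin n → Carrier
      Mb r = M r (suc b)
      Mb′ r = M r b′
      N = replaceCol M (suc b) Mb′

  det-equalColumns : ∀ {n} (M : Matrix n) {a b} → a ≢ b → (∀ r → M r a ≈ M r b) → det F n M ≈ 0#
  det-equalColumns M {a} {b} a≢b Ma≈Mb with ℕ.<-cmp (toℕ a) (toℕ b)
  ... | tri< a<b _ _ = det-equalColumns-apart (toℕ b ∸ suc (toℕ a)) M (≡.sym (1+[n∸1+m]+m≡n a<b)) Ma≈Mb
  ... | tri≈ _ a≡b _ = contradiction (Fin.toℕ-injective a≡b) a≢b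
  ... | tri> _ _ b<a = det-equalColumns-apart (toℕ a ∸ suc (toℕ b)) M (≡.sym (1+[n∸1+m]+m≡n b<a)) (sym ∘ Ma≈Mb)

  -- The hypothesis says M = X U with U upper triangular, U_(j+t, j) = w j t.
  module TriangularCombination {n} (X : Fin n → ℕ → Carrier) (w : ℕ → ℕ → Carrier) (M : Matrix n)
    (M≈XU : ∀ r j → M r j ≈ ∑ (n ∸ toℕ j) (λ t → w (toℕ j) (toℕ t) * X r (toℕ j ℕ.+ toℕ t))) where

    S : ℕ → Matrix n
    S k r j with toℕ j <? k
    ... | yes _ = M r j
    ... | no  _ = X r (toℕ j)

    S-below : ∀ {k j} → toℕ j < k → ∀ r → S k r j ≡ M r j
    S-below {k} {j} j<k r with toℕ j <? k
    ... | yes _   = ≡.refl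
    ... | no j≮k  = contradiction j<k j≮k

    S-above : ∀ {k j} → k ≤ toℕ j → ∀ r → S k r j ≡ X r (toℕ j)
    S-above {k} {j} k≤j r with toℕ j <? k
    ... | yes j<k = contradiction k≤j (ℕ.<⇒≱ j<k)
    ... | no _    = ≡.refl

    S-suc : ∀ {k j} → toℕ j ≢ k → ∀ r → S (suc k) r j ≡ S k r j
    S-suc {k} {j} j≢k r with toℕ j <? k
    ... | yes j<k = S-below (ℕ.m<n⇒m<1+n j<k) r
    ... | no j≮k  = S-above (ℕ.≤∧≢⇒< (ℕ.≮⇒≥ j≮k) (j≢k ∘ ≡.sym)) r

    module _ {k} (k<n : k < n) where
      private
        c = fromℕ< k<n
        c≡k : toℕ c ≡ k
        c≡k = Fin.toℕ-fromℕ< k<n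

      Xcol : ℕ → Fin n → Carrier
      Xcol t r = X r (k ℕ.+ t)

      S-column : ∀ r → S (suc k) r c ≈ ∑ (n ∸ k) (λ t → w k (toℕ t) * Xcol (toℕ t) r)
      S-column r = trans (reflexive (S-below (≡.subst (_< suc k) (≡.sym c≡k) (ℕ.n<1+n k)) r))
        (trans (M≈XU r c) (reflexive (≡.cong (λ i → ∑ (n ∸ i) (λ t → w i (toℕ t) * X r (i ℕ.+ toℕ t))) c≡k)))

      S-replaceCol-head : replaceCol (S (suc k)) c (Xcol 0) ≋ S k
      S-replaceCol-head r s with s ≟ᶠ c
      ... | yes ≡.refl = reflexive (≡.trans (replaceCol-at (S (suc k)) s (Xcol 0) r) (≡.trans
              (≡.cong (X r) (≡.trans (ℕ.+-identityʳ k) (≡.sym c≡k))) (≡.sym (S-above (ℕ.≤-reflexive (≡.sym c≡k)) r))))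
      ... | no s≢c     = reflexive (≡.trans (replaceCol-off (S (suc k)) (Xcol 0) r s≢c)
              (S-suc (λ e → s≢c (Fin.toℕ-injective (≡.trans e (≡.sym c≡k)))) r))

      det-S-replaceCol-tail : ∀ t → 0 < t → t < n ∸ k → det F n (replaceCol (S (suc k)) c (Xcol t)) ≈ 0#
      det-S-replaceCol-tail t 0<t t<n∸k = det-equalColumns (replaceCol (S (suc k)) c (Xcol t)) c≢c′ λ r →
        reflexive (≡.trans (replaceCol-at (S (suc k)) c (Xcol t) r) (≡.sym (≡.trans
          (replaceCol-off (S (suc k)) (Xcol t) r (c≢c′ ∘ ≡.sym))
          (≡.trans (S-above (≡.subst (suc k ≤_) (≡.sym c′≡k+t) (ℕ.m<m+n k 0<t)) r) (≡.cong (X r) c′≡k+t)))))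
        where
        k+t<n : k ℕ.+ t < n
        k+t<n = ≡.subst (k ℕ.+ t <_) (ℕ.m+[n∸m]≡n (ℕ.<⇒≤ k<n)) (ℕ.+-monoʳ-< k t<n∸k)
        c′ = fromℕ< k+t<n
        c′≡k+t : toℕ c′ ≡ k ℕ.+ t
        c′≡k+t = Fin.toℕ-fromℕ< k+t<n
        c≢c′ : c ≢ c′
        c≢c′ e = ℕ.<⇒≢ (ℕ.m<m+n k 0<t) (≡.trans (≡.sym c≡k) (≡.trans (≡.cong toℕ e) c′≡k+t))

      det-S-suc : det F n (S (suc k)) ≈ w k 0 * det F n (S k)
      det-S-suc = begin
        det F n (S (suc k))       ≈⟨ det-cong (replaceCol-own (S (suc k)) c (sym ∘ S-column)) ⟨
        det F n (replaceCol (S (suc k)) c (λ r → ∑ (n ∸ k) (λ t → w k (toℕ t) * Xcol (toℕ t) r)))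
          ≈⟨ det-replaceCol-∑ (S (suc k)) c {n ∸ k} (λ t → w k (toℕ t)) (Xcol ∘ toℕ) ⟩
        ∑ (n ∸ k) (λ t → g (toℕ t))                     ≈⟨ ∑-single-zero g (ℕ.m<n⇒0<n∸m k<n) g-tail≈0 ⟩
        w k 0 * det F n (replaceCol (S (suc k)) c (Xcol 0)) ≈⟨ *-congˡ (det-cong S-replaceCol-head) ⟩
        w k 0 * det F n (S k)                           ∎
        where
        g : ℕ → Carrier
        g t = w k t * det F n (replaceCol (S (suc k)) c (Xcol t))
        g-tail≈0 : ∀ t → 0 < t → t < n ∸ k → g t ≈ 0#
        g-tail≈0 t 0<t t<n∸k = trans (*-congˡ (det-S-replaceCol-tail t 0<t t<n∸k)) (zeroʳ _)

    det-S : ∀ k → k ≤ n → det F n (S k) ≈ ∏ k (λ j → w j 0) * det F n (λ r s → X r (toℕ s))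
    det-S zero    _   = trans (det-cong (λ r s → reflexive (S-above z≤n r))) (sym (*-identityˡ _))
    det-S (suc k) k<n = begin
      det F n (S (suc k))                             ≈⟨ det-S-suc k<n ⟩
      w k 0 * det F n (S k)                           ≈⟨ *-congˡ (det-S k (ℕ.<⇒≤ k<n)) ⟩
      w k 0 * (∏ k (λ j → w j 0) * _)                 ≈⟨ x∙yz≈yx∙z _ _ _ ⟩
      ∏ (suc k) (λ j → w j 0) * det F n (λ r s → X r (toℕ s)) ∎

  det-triangularCombination : ∀ {n} (X : Fin n → ℕ → Carrier) (w : ℕ → ℕ → Carrier) (M : Matrix n) →
    (∀ r j → M r j ≈ ∑ (n ∸ toℕ j) (λ t → w (toℕ j) (toℕ t) * X r (toℕ j ℕ.+ toℕ t))) →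
    det F n M ≈ ∏ n (λ j → w j 0) * det F n (λ r s → X r (toℕ s))
  det-triangularCombination {n} X w M M≈XU =
    trans (det-cong (λ r j → reflexive (≡.sym (S-below (Fin.toℕ<n j) r)))) (det-S n ℕ.≤-refl)
    where open TriangularCombination X w M M≈XU

module HankelCofactors {ℓ₁ ℓ₂ : Level} (F : Field ℓ₁ ℓ₂) (C : ℕ → ℕ → Field.Carrier F) where
  open Field F hiding (zero)
  open Product F
  open Determinant F
  open Tri F C
  open import Relation.Binary.Reasoning.Setoid setoid
  open import Algebra.Properties.CommutativeSemigroup *-commutativeSemigroup using (x∙yz≈zx∙y)

  -- Rows 1,…,q of the numerator matrix of 𝒦 (suc q) (headSeq a (suc q)) do not depend on a.
  cofactor : ∀ q → Fin (suc q) → Carrier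
  cofactor q = det F q ∘ minor (numMat (suc q) (headSeq (+ 0) (suc q)))

  cofactor-zero : ∀ q → cofactor q zero ≈ hankel q
  cofactor-zero q = det-cong λ r s → reflexive (≡.cong 𝒵ℤ (≡.trans
    (+m-+n≡+[m∸n] (i+j+2≤l+2n 0 (s≤s (Fin.toℕ<n r)) (s≤s (Fin.toℕ<n s))))
    (≡.cong +_ (hankel-exponent q (toℕ r) (toℕ s)))))

  -- Indexed by the size p and a column t : ℕ, with a junk value 0 beyond the last column.
  signedCofactor : ℕ → ℕ → Carrier
  signedCofactor zero    t = 0#
  signedCofactor (suc q) t with t <? suc q
  ... | yes t<1+q = signed F t (cofactor q (fromℕ< t<1+q))
  ... | no  _     = 0#

  signedCofactor-toℕ : ∀ q (t : Fin (suc q)) → signedCofactor (suc q) (toℕ t) ≡ signed F (toℕ t) (cofactor q t)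
  signedCofactor-toℕ q t with toℕ t <? suc q
  ... | yes t<1+q = ≡.cong (signed F (toℕ t) ∘ cofactor q) (Fin.fromℕ<-toℕ t t<1+q)
  ... | no t≮1+q  = contradiction (Fin.toℕ<n t) t≮1+q

  𝒦-headSeq : ∀ {p} a → 0 < p →
    𝒦 p (headSeq a p) ≈
    ∑ p (λ t → (signedCofactor p (toℕ t) * hankel p ⁻¹) * 𝒵ℤ (a ℤ.+ + (2 ℕ.* p) ℤ.- + (toℕ t ℕ.+ 2)))
  𝒦-headSeq {suc q} a _ = begin
    ∑ (suc q) (laplaceTerm N) * h                ≈⟨ *-comm _ h ⟩
    h * ∑ (suc q) (laplaceTerm N)                ≈⟨ ∑-distribˡ-* h (laplaceTerm N) ⟨
    ∑ (suc q) (λ t → h * laplaceTerm N t)        ≈⟨ ∑-cong term ⟩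
    ∑ (suc q) (λ t → (signedCofactor (suc q) (toℕ t) * h) * N zero t) ∎
    where
    N = numMat (suc q) (headSeq a (suc q))
    h = hankel (suc q) ⁻¹
    term : ∀ t → h * laplaceTerm N t ≈ (signedCofactor (suc q) (toℕ t) * h) * N zero t
    term t = begin
      h * signed F (toℕ t) (N zero t * cofactor q t)    ≈⟨ *-congˡ (signed-* (toℕ t) (N zero t) (cofactor q t)) ⟩
      h * (N zero t * signed F (toℕ t) (cofactor q t))  ≈⟨ x∙yz≈zx∙y h (N zero t) _ ⟩
      (signed F (toℕ t) (cofactor q t) * h) * N zero t  ≈⟨ *-congʳ (*-congʳ (reflexive (signedCofactor-toℕ q t))) ⟨
      (signedCofactor (suc q) (toℕ t) * h) * N zero t   ∎

  module Entries (n : ℕ) where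
    numerator : (Fin n → ℕ) → Fin n → ℕ → Carrier
    numerator λ′ r s = 𝒵 ((λ′ r ℕ.+ 2 ℕ.* n) ∸ (toℕ r ℕ.+ s ℕ.+ 2))

    coefficient : ℕ → ℕ → Carrier
    coefficient j t = signedCofactor (n ∸ j) t * hankel (n ∸ j) ⁻¹

    numMat≋numerator : ∀ λ′ → numMat n (λ i → + λ′ i) ≋ (λ r s → numerator λ′ r (toℕ s))
    numMat≋numerator λ′ r s =
      reflexive (≡.cong 𝒵ℤ (+m-+n≡+[m∸n] (i+j+2≤l+2n (λ′ r) (Fin.toℕ<n r) (Fin.toℕ<n s))))

    𝒦-entry : ∀ λ′ i j →
      𝒦 (n ∸ toℕ j) (headSeq ((+ λ′ i ℤ.+ + toℕ j) ℤ.- + toℕ i) (n ∸ toℕ j)) ≈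
      ∑ (n ∸ toℕ j) (λ t → coefficient (toℕ j) (toℕ t) * numerator λ′ i (toℕ j ℕ.+ toℕ t))
    𝒦-entry λ′ i j = trans (𝒦-headSeq _ (ℕ.m<n⇒0<n∸m j<n)) (∑-cong λ t →
      *-congˡ (reflexive (≡.cong 𝒵ℤ (headSeq-exponent (λ′ i) (Fin.toℕ<n i) (j+t<n t)))))
      where
      j<n = Fin.toℕ<n j
      j+t<n : ∀ (t : Fin (n ∸ toℕ j)) → toℕ j ℕ.+ toℕ t < n
      j+t<n t = ≡.subst (toℕ j ℕ.+ toℕ t <_) (ℕ.m+[n∸m]≡n (ℕ.<⇒≤ j<n)) (ℕ.+-monoʳ-< (toℕ j) (Fin.toℕ<n t))

    coefficient-diagonal : ∀ j → j < n → coefficient j 0 ≈ hankel (n ∸ suc j) * hankel (n ∸ j) ⁻¹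
    coefficient-diagonal j j<n = *-congʳ (begin
      signedCofactor (n ∸ j) 0             ≡⟨ ≡.cong (λ p → signedCofactor p 0) (ℕ.+-∸-assoc 1 j<n) ⟩
      signedCofactor (suc (n ∸ suc j)) 0   ≡⟨ signedCofactor-toℕ (n ∸ suc j) zero ⟩
      cofactor (n ∸ suc j) zero            ≈⟨ cofactor-zero (n ∸ suc j) ⟩
      hankel (n ∸ suc j)                   ∎)

    ∏-coefficient-diagonal : (∀ p → 1 ≤ p → p ≤ n → ¬ (hankel p ≈ 0#)) →
                             ∏ n (λ j → coefficient j 0) ≈ hankel n ⁻¹
    ∏-coefficient-diagonal hankel≉0 = begin
      ∏ n (λ j → coefficient j 0)               ≈⟨ ∏-cong n coefficient-diagonal ⟩
      ∏ n (λ j → g (suc j) * g j ⁻¹)            ≈⟨ ∏-telescope g n (λ j _ → invertible (n ∸ j) (ℕ.m∸n≤m n j)) ⟩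
      g n * g 0 ⁻¹                              ≡⟨ ≡.cong (λ p → hankel p * hankel n ⁻¹) (ℕ.n∸n≡0 n) ⟩
      1# * hankel n ⁻¹                          ≈⟨ *-identityˡ _ ⟩
      hankel n ⁻¹                               ∎
      where
      g : ℕ → Carrier
      g j = hankel (n ∸ j)
      invertible : ∀ p → p ≤ n → hankel p * hankel p ⁻¹ ≈ 1#
      invertible zero    _   = ⁻¹-inverse 1# (0≉1 ∘ sym)
      invertible (suc p) 1+p≤n = ⁻¹-inverse _ (hankel≉0 (suc p) (s≤s z≤n) 1+p≤n)

theorem5p1 : ∀ {c ℓ : Level} (F : Field c ℓ) (C : ℕ → ℕ → Field.Carrier F)
    → IsTridiagonal F C
    → BandNonzero F C
    → (n : ℕ) (λ′ : Fin n → ℕ) → IsPartition λ′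
    → (∀ p → 1 ≤ p → p ≤ n → ¬ (Field._≈_ F (Tri.hankel F C p) (Field.0# F)))
    → Field._≈_ F
        (Tri.𝒦 F C n (λ i → + (λ′ i)))
        (det F n (λ i j → Tri.𝒦 F C (n ∸ toℕ j)
                            (headSeq ((+ (λ′ i) ℤ.+ + (toℕ j)) ℤ.- + (toℕ i)) (n ∸ toℕ j))))
theorem5p1 F C _ _ n λ′ _ hankel≉0 = begin
  det F n (numMat n μ) * hankel n ⁻¹         ≈⟨ *-congʳ (det-cong (numMat≋numerator λ′)) ⟩
  det F n X * hankel n ⁻¹                    ≈⟨ *-comm _ _ ⟩
  hankel n ⁻¹ * det F n X                    ≈⟨ *-congʳ (∏-coefficient-diagonal hankel≉0) ⟨
  ∏ n (λ j → coefficient j 0) * det F n X    ≈⟨ det-triangularCombination (numerator λ′) coefficient _ (𝒦-entry λ′) ⟨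
  det F n (λ i j → 𝒦 (n ∸ toℕ j) (headSeq ((+ λ′ i ℤ.+ + toℕ j) ℤ.- + toℕ i) (n ∸ toℕ j))) ∎
  where
  open Field F hiding (zero)
  open Product F using (∏)
  open Determinant F using (det-cong; det-triangularCombination)
  open HankelCofactors F C
  open Entries n
  open Tri F C
  open import Relation.Binary.Reasoning.Setoid setoid
  μ : Fin n → ℤ
  μ i = + λ′ i
  X : Fin n → Fin n → Carrier
  X r s = numerator λ′ r (toℕ s)
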